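{- Fix $\Join\,\in\{;,\parallel\}$. Let $\mathcal{X}$ and $\mathcal{Y}$ be elementary programs such that $\bot \notin \mathcal{Y}$, and suppose $\mathcal{X} \subseteq \mathcal{Y}^{\Join}$. Let $\ell_\mathcal{X} = \max\{|x| : x \in \mathcal{X}\}$, $\ell_\mathcal{Y} = \min\{|y| : y \in \mathcal{Y}\}$ and $n = \lfloor \ell_\mathcal{X}/\ell_\mathcal{Y} \rfloor$. Then $\mathcal{X} \subseteq \bigcup_{k=0}^{n} \mathcal{Y}^{k\cdot\Join}$.
   Context: Fix a nonempty set $E$ of events and an alphabet $\Gamma$. A partial string is a triple $p = (E_p, \alpha_p, \preceq_p)$ with $E_p \subseteq E$, $\alpha_p \colon E_p \to \Gamma$ and $\preceq_p$ a partial order on $E_p$; $\mathsf{P}_f$ is the set of finite partial strings; $|p| = |E_p|$; $\bot$ is the empty partial string. Partial strings are made disjoint by renaming events when composed. For disjoint $x,y$, $x \parallel y$ and $x ; y$ both have event set $E_x \cup E_y$ and inherited labels; $e \preceq_{x\parallel y} e'$ iff $e \preceq_x e'$ or $e \preceq_y e'$; $e \preceq_{x;y} e'$ iff ($e \in E_x$ and $e' \in E_y$) or $e \preceq_{x\parallel y} e'$. Write $x \sqsubseteq y$ if there is a bijection $f\colon E_y \to E_x$ preserving labels with $e \preceq_y e' \Rightarrow f(e) \preceq_x f(e')$. ${\downarrow}\mathcal{X} = \{y \in \mathsf{P}_f : \exists x \in \mathcal{X},\ y \sqsubseteq x\}$. A program is $\mathcal{X} \subseteq \mathsf{P}_f$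 with ${\downarrow}\mathcal{X} = \mathcal{X}$. Put $1 = \{\bot\}$, $\mathcal{X} \Join \mathcal{Y} = {\downarrow}\{x \Join y : x \in \mathcal{X}, y \in \mathcal{Y}\}$. $\mathcal{P}^{\Join}$ is the least fixed point (among programs, under $\subseteq$) of $\mathcal{Z} \mapsto 1 \cup (\mathcal{P} \Join \mathcal{Z})$; $\mathcal{P}^{0\cdot\Join} = 1$, $\mathcal{P}^{(n+1)\cdot\Join} = \mathcal{P} \Join \mathcal{P}^{n\cdot\Join}$. A program is elementary if it equals ${\downarrow}\mathcal{Q}$ for a finite nonempty set $\mathcal{Q} \subseteq \mathsf{P}_f$. -}

module Defs where

import Level
open import Level using (0ℓ)
open import Data.Nat using (ℕ; zero; suc; _+_; _≤_)
open import Data.Nat.DivMod using (_/_)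
open import Data.Fin using (Fin; splitAt; join)
open import Data.Fin.Properties using (join-splitAt)
open import Data.Sum using (_⊎_; inj₁; inj₂)
open import Data.Product using (Σ; _×_; _,_; ∃; ∃-syntax)
open import Data.List.NonEmpty using (List⁺; toList)
open import Data.List.Relation.Unary.Any using (Any)
open import Data.Empty using (⊥)
open import Relation.Nullary using (¬_)
open import Relation.Unary using (Pred; _⊆_)
open import Relation.Binary using (Rel; IsPartialOrder)
open import Relation.Binary.PropositionalEquality
  using (_≡_; refl; subst; cong; isEquivalence; trans; sym)
open import Function.Bundles using (_⤖_; Bijection; _⇔_)
import Data.Sum.Relation.Binary.Pointwise as PW
import Data.Sum.Relation.Binary.LeftOrder as LO

-- Finite partial strings, with event set represented (up to renaming) by Fin n.
record PString (Γ : Set) : Set₁ where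
  constructor pstr
  field
    size  : ℕ
    lab   : Fin size → Γ
    _≼_   : Rel (Fin size) 0ℓ
    isPO  : IsPartialOrder _≡_ _≼_
open PString public

∣_∣ : ∀ {Γ} → PString Γ → ℕ
∣ p ∣ = size p

botP : ∀ {Γ} → PString Γ
botP = pstr 0 (λ ()) (λ _ _ → ⊥) record
  { isPreorder = record
    { isEquivalence = isEquivalence
    ; reflexive = λ { {()} }
    ; trans = λ { {()} } }
  ; antisym = λ { {()} } }

pullback : ∀ m n (R : Rel (Fin m ⊎ Fin n) 0ℓ) →
           IsPartialOrder (PW.Pointwise _≡_ _≡_) R →
           IsPartialOrder _≡_ (λ i j → R (splitAt m i) (splitAt m j))
pullback m n R po = record
  { isPreorder = record
    { isEquivalence = isEquivalence
    ; reflexive = λ { refl → IsPartialOrder.refl po }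
    ; trans = IsPartialOrder.trans po }
  ; antisym = λ {i} {j} p q →
      trans (sym (join-splitAt m n i))
        (trans (cong (join m n) (PW.Pointwise-≡⇒≡ (IsPartialOrder.antisym po p q)))
               (join-splitAt m n j)) }

data Op : Set where
  seq par : Op

compose : ∀ {Γ} → Op → PString Γ → PString Γ → PString Γ
compose {Γ} par x y = pstr (size x + size y)
  (λ i → lab' (splitAt (size x) i))
  (λ i j → PW.Pointwise (_≼_ x) (_≼_ y) (splitAt (size x) i) (splitAt (size x) j))
  (pullback (size x) (size y) _ (PW.⊎-isPartialOrder (isPO x) (isPO y)))
  where
  lab' : Fin (size x) ⊎ Fin (size y) → Γ
  lab' (inj₁ i) = lab x i
  lab' (inj₂ j) = lab y j
compose {Γ} seq x y = pstr (size x + size y)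
  (λ i → lab' (splitAt (size x) i))
  (λ i j → LO._⊎-<_ (_≼_ x) (_≼_ y) (splitAt (size x) i) (splitAt (size x) j))
  (pullback (size x) (size y) _ (LO.⊎-<-isPartialOrder (isPO x) (isPO y)))
  where
  lab' : Fin (size x) ⊎ Fin (size y) → Γ
  lab' (inj₁ i) = lab x i
  lab' (inj₂ j) = lab y j

_⊑_ : ∀ {Γ} → PString Γ → PString Γ → Set
x ⊑ y = Σ (Fin (size y) ⤖ Fin (size x)) λ f →
          (∀ e → lab x (Bijection.to f e) ≡ lab y e) ×
          (∀ e e' → _≼_ y e e' → _≼_ x (Bijection.to f e) (Bijection.to f e'))

PSet : Set → Set₂
PSet Γ = Pred (PString Γ) (Level.suc 0ℓ)

IsProgram : ∀ {Γ} → PSet Γ → Set₁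
IsProgram X = ∀ {x y} → y ⊑ x → X x → X y

-- 1 = {⊥}  (taken up to renaming of events, i.e. ↓{⊥})
one : ∀ {Γ} → PSet Γ
one x = Level.Lift _ (x ⊑ botP)

comp : ∀ {Γ} → Op → PSet Γ → PSet Γ → PSet Γ
comp o X Y z = ∃[ x ] ∃[ y ] (X x × Y y × z ⊑ compose o x y)

-- P^⋈ : least fixed point of Z ↦ 1 ∪ (P ⋈ Z), given as an inductive predicate
data star {Γ} (o : Op) (P : PSet Γ) : PSet Γ where
  star-one  : ∀ {z} → one z → star o P z
  star-step : ∀ {z} x y → P x → star o P y → z ⊑ compose o x y → star o P z

pow : ∀ {Γ} → Op → PSet Γ → ℕ → PSet Γ
pow o P zero    = one
pow o P (suc k) = comp o P (pow o P k)

Elementary : ∀ {Γ} → PSet Γ → Set₁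
Elementary {Γ} X = Σ (List⁺ (PString Γ)) λ Q →
  ∀ x → X x ⇔ Any (x ⊑_) (toList Q)

IsMaxSize : ∀ {Γ} → PSet Γ → ℕ → Set₁
IsMaxSize X ℓ = (∃[ x ] (X x × ∣ x ∣ ≡ ℓ)) × (∀ x → X x → ∣ x ∣ ≤ ℓ)

IsMinSize : ∀ {Γ} → PSet Γ → ℕ → Set₁
IsMinSize X ℓ = (∃[ x ] (X x × ∣ x ∣ ≡ ℓ)) × (∀ x → X x → ℓ ≤ ∣ x ∣)

-- floor division (totalised at 0; never used at 0 in the theorem)
_div_ : ℕ → ℕ → ℕ
m div zero    = 0
m div (suc k) = m / suc k

module Submission where

-- Every element z of the iteration Y^⋈ is built by finitely many
-- ⋈-steps, each adding one element of Y, so z lies in some power Y^{k·⋈}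
-- (star⇒pow).  Renaming preserves the number of events and composition adds
-- them, so if every element of Y has at least ℓ events, every element of
-- Y^{k·⋈} has at least k·ℓ events (pow-size).  For x ∈ X ⊆ Y^⋈ this yields
-- k·ℓY ≤ |x| ≤ ℓX, hence k ≤ ⌊ℓX/ℓY⌋ (≤-div-of-*≤).  The quotient is only
-- meaningful for ℓY > 0, and indeed ℓY = 0 is impossible: an elementary
-- program containing an empty partial string contains ⊥ (elementary-has-bot),
-- which contradicts ⊥ ∉ Y.

open import Defs
open import Data.Nat using (ℕ; _≤_; zero; suc; _*_; _+_; z≤n; NonZero)
open import Data.Nat.Properties using (≤-trans; ≤-reflexive; +-mono-≤)
open import Data.Nat.DivMod using (_/_; m*n/n≡m; /-monoˡ-≤)
open import Data.Product using (_×_; ∃-syntax; _,_)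
open import Data.Empty using (⊥-elim)
open import Relation.Nullary using (¬_)
open import Relation.Unary using (_⊆_)
open import Relation.Binary.PropositionalEquality using (_≡_; refl; sym; trans; subst)
open import Function.Bundles using (Equivalence)
open import Function.Properties.Bijection using (⤖⇒↔)
open import Function.Construct.Identity using (⤖-id)
open import Data.Fin using (Fin)
open import Data.Fin.Permutation using (↔⇒≡)
open import Data.List.Relation.Unary.Any as Any using ()

⊑-size : ∀ {Γ} (x y : PString Γ) → x ⊑ y → ∣ y ∣ ≡ ∣ x ∣
⊑-size _ _ (f , _) = ↔⇒≡ (⤖⇒↔ f)

compose-size : ∀ {Γ} o (x y : PString Γ) → ∣ compose o x y ∣ ≡ ∣ x ∣ + ∣ y ∣
compose-size seq x y = refl
compose-size par x y = refl

⊑-compose-size : ∀ {Γ} o (z x y : PString Γ) → z ⊑ compose o x y →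
                 ∣ x ∣ + ∣ y ∣ ≡ ∣ z ∣
⊑-compose-size o z x y z⊑xy =
  trans (sym (compose-size o x y)) (⊑-size z (compose o x y) z⊑xy)

bot-⊑-empty : ∀ {Γ} (q : PString Γ) → ∣ q ∣ ≡ 0 → botP ⊑ q
bot-⊑-empty (pstr .0 _ _ _) refl = ⤖-id (Fin 0) , (λ ()) , (λ ())

-- An elementary program containing a partial string without events contains ⊥:
-- the string is a renaming of a generator q, which then has no events either.
elementary-has-bot : ∀ {Γ} {X : PSet Γ} → Elementary X →
                     ∀ {y} → X y → ∣ y ∣ ≡ 0 → X botP
elementary-has-bot (Q , X⇔↓Q) {y} yX y-empty =
  Equivalence.from (X⇔↓Q botP)
    (Any.map (λ {q} y⊑q → bot-⊑-empty q (trans (⊑-size y q y⊑q) y-empty))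
             (Equivalence.to (X⇔↓Q y) yX))

star⇒pow : ∀ {Γ} {o} {P : PSet Γ} {z} → star o P z → ∃[ k ] pow o P k z
star⇒pow (star-one z∈1) = 0 , z∈1
star⇒pow (star-step x y xP yP* z⊑xy) with star⇒pow yP*
... | k , y∈Pᵏ = suc k , (x , y , xP , y∈Pᵏ , z⊑xy)

pow-size : ∀ {Γ} {o} {P : PSet Γ} {ℓ} → (∀ y → P y → ℓ ≤ ∣ y ∣) →
           ∀ k {z} → pow o P k z → k * ℓ ≤ ∣ z ∣
pow-size P-large zero    _                          = z≤n
pow-size {o = o} P-large (suc k) {z} (x , y , xP , y∈Pᵏ , z⊑xy) =
  ≤-trans (+-mono-≤ (P-large x xP) (pow-size P-large k y∈Pᵏ))
          (≤-reflexive (⊑-compose-size o z x y z⊑xy))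

≤-div-of-*≤ : ∀ k m n .{{_ : NonZero n}} → k * n ≤ m → k ≤ m / n
≤-div-of-*≤ k m n k*n≤m =
  subst (_≤ m / n) (m*n/n≡m k n) (/-monoˡ-≤ n k*n≤m)

proposition4 : {Γ : Set} (o : Op) (X Y : PSet Γ) →
    Elementary X → Elementary Y → ¬ Y botP → X ⊆ star o Y →
    (ℓX ℓY : ℕ) → IsMaxSize X ℓX → IsMinSize Y ℓY →
    X ⊆ (λ x → ∃[ k ] (k ≤ ℓX div ℓY × pow o Y k x))
proposition4 _ _ _ _ elemY ⊥∉Y _ _ zero _ ((y , yY , y-empty) , _) _ =
  ⊥-elim (⊥∉Y (elementary-has-bot elemY yY y-empty))
proposition4 _ _ _ _ _ _ X⊆Y* ℓX ℓY@(suc _) (_ , X-small) (_ , Y-large) {x} xX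
  with star⇒pow (X⊆Y* xX)
... | k , x∈Yᵏ =
  k , ≤-div-of-*≤ k ℓX ℓY (≤-trans (pow-size Y-large k x∈Yᵏ) (X-small x xX)) , x∈Yᵏ
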